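{- Let $\mathcal{V}$ be a characteristic vector set function equipped with a canonical ordering, and for $A\in\mathcal{S}^n_{>0}$ define $\mathrm{Can}_{\mathrm{GL}_n(\mathbb{Z})}(A)=U_{\mathcal{V}(A)}^{\mathsf{T}}\,A\,U_{\mathcal{V}(A)}$ as in the context. Then $A\mapsto\mathrm{Can}_{\mathrm{GL}_n(\mathbb{Z})}(A)$ is a canonical form, i.e. (i) $\mathrm{Can}_{\mathrm{GL}_n(\mathbb{Z})}(A)$ is equivalent to $A$ for every $A\in\mathcal{S}^n_{>0}$, and (ii) $\mathrm{Can}_{\mathrm{GL}_n(\mathbb{Z})}(P^{\mathsf{T}}AP)=\mathrm{Can}_{\mathrm{GL}_n(\mathbb{Z})}(A)$ for every $A\in\mathcal{S}^n_{>0}$ and $P\in\mathrm{GL}_n(\mathbb{Z})$.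
   Context: $\mathcal{S}^n_{>0}$ is the set of positive definite symmetric real $n\times n$ matrices (forms); $A,B$ are equivalent if $A=U^{\mathsf{T}}BU$ with $U\in\mathrm{GL}_n(\mathbb{Z})$; $\mathrm{Stab}(A)=\{U\in\mathrm{GL}_n(\mathbb{Z}):U^{\mathsf{T}}AU=A\}$. A characteristic vector set function assigns to every $n\ge1$ and form $A$ a finite set $\mathcal{V}(A)\subseteq\mathbb{Z}^n$ generating $\mathbb{Z}^n$ as a $\mathbb{Z}$-module, with $U^{ -1}\mathcal{V}(A)=\mathcal{V}(U^{\mathsf{T}}AU)$ for all $U\in\mathrm{GL}_n(\mathbb{Z})$. A canonical ordering assigns to each $A$ an ordering $(v_1,\dots,v_p)$ of $\mathcal{V}(A)$, determined up to $\mathrm{Stab}(A)$ and compatible with equivalence: any other admissible ordering of $\mathcal{V}(A)$ is $(Sv_1,\dots,Sv_p)$ for some $S\in\mathrm{Stab}(A)$, and for $P\in\mathrm{GL}_n(\mathbb{Z})$ the ordering of $\mathcal{V}(P^{\mathsf{T}}AP)=P^{ -1}\mathcal{V}(A)$ is $(P^{ -1}Sv_1,\dots,P^{ -1}Sv_p)$ for some $S\in\mathrm{Stab}(A)$ (in the paper such an ordering is obtained from a canonical vertex ordering of a weighted graph built from the Gram values $v_i^{\mathsf{T}}Av_j$). The Hermite normal form of $Q\in\mathrm{M}_{m,k}(\mathbb{Z})$ is the unique $H=(h_{ij})\in\mathrm{M}_{m,k}(\mathbb{Z})$ such that $Q=UH$ for some $U\in\mathrm{GL}_m(\mathbb{Z})$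 and: the first $r$ rows of $H$ are nonzero and the rest zero; if $h_{i,j_i}$ is the first nonzero entry of row $i$ then $j_1<\dots<j_r$; $h_{i,j_i}>0$; and $0\le h_{k,j_i}<h_{i,j_i}$ for $1\le k<i\le r$. Let $Q_A\in\mathrm{M}_{n,p}(\mathbb{Z})$ be the matrix with columns $v_1,\dots,v_p$ (canonical ordering); it has full rank $n$, so $U$ in $Q_A=UH$ is unique; denote it $U_{\mathcal{V}(A)}$. -}

module Defs where

open import Level using (Level; _⊔_) renaming (suc to lsuc)
open import Data.Nat using (ℕ; zero; suc) renaming (_≤_ to _≤ℕ_; _<_ to _<ℕ_)
open import Data.Integer as ℤ using (ℤ; +_; -[1+_]; 0ℤ; 1ℤ) renaming (_+_ to _+ℤ_; _*_ to _*ℤ_)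
open import Data.Fin using (Fin; toℕ; inject≤) renaming (_≟_ to _≟F_; zero to fzero; suc to fsuc)
open import Data.Vec using (Vec; lookup; tabulate)
open import Data.List using (List; length; map)
import Data.List as L
import Data.List.Membership.Propositional as Mem
open import Data.List.Relation.Unary.Unique.Propositional using (Unique)
open import Data.Product using (Σ; ∃; _×_; _,_)
open import Function.Bundles using (_⇔_)
open import Relation.Nullary using (¬_; does)
open import Data.Bool using (if_then_else_)
open import Relation.Binary.PropositionalEquality using (_≡_)
open import Algebra.Bundles using (CommutativeRing)

∑ : ∀ {a} {A : Set a} → (A → A → A) → A → (n : ℕ) → (Fin n → A) → A
∑ _⊕_ e zero    f = e
∑ _⊕_ e (suc n) f = f fzero ⊕ ∑ _⊕_ e n (λ i → f (fsuc i))

∑ℤ : (n : ℕ) → (Fin n → ℤ) → ℤ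
∑ℤ = ∑ _+ℤ_ 0ℤ

ZMat : ℕ → ℕ → Set
ZMat m n = Fin m → Fin n → ℤ

_·ℤ_ : ∀ {m k n} → ZMat m k → ZMat k n → ZMat m n
_·ℤ_ {k = k} U V i j = ∑ℤ k (λ l → U i l *ℤ V l j)

idℤ : ∀ {n} → ZMat n n
idℤ i j = if does (i ≟F j) then 1ℤ else 0ℤ

IsInverse : ∀ {n} → ZMat n n → ZMat n n → Set
IsInverse U V = (∀ i j → (U ·ℤ V) i j ≡ idℤ i j) × (∀ i j → (V ·ℤ U) i j ≡ idℤ i j)

GL : ∀ {n} → ZMat n n → Set
GL U = ∃ λ V → IsInverse U V

_·v_ : ∀ {m n} → ZMat m n → Vec ℤ n → Vec ℤ m
_·v_ {n = n} U v = tabulate (λ i → ∑ℤ n (λ j → U i j *ℤ lookup v j))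

Generates : ∀ {n} → List (Vec ℤ n) → Set
Generates {n} vs = ∀ (w : Vec ℤ n) → ∃ λ (c : Fin (length vs) → ℤ) →
  ∀ i → lookup w i ≡ ∑ℤ (length vs) (λ j → c j *ℤ lookup (L.lookup vs j) i)

colMat : ∀ {n} → (vs : List (Vec ℤ n)) → ZMat n (length vs)
colMat vs i j = lookup (L.lookup vs j) i

-- Hermite normal form, exactly as in the paper's definition.
-- r = number of nonzero rows; piv i = column j_i of the first nonzero entry of row i.
IsHNF : ∀ {m k} → ZMat m k → Set
IsHNF {m} {k} H =
  Σ ℕ λ r → Σ (r ≤ℕ m) λ r≤m → Σ (Fin r → Fin k) λ piv →
    (∀ (i : Fin m) → r ≤ℕ toℕ i → ∀ j → H i j ≡ 0ℤ)
  ×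
    (∀ (i : Fin r) (j : Fin k) → toℕ j <ℕ toℕ (piv i) → H (inject≤ i r≤m) j ≡ 0ℤ)
  × -- pivots are positive (hence rows 1,…,r are nonzero and piv i is the first nonzero entry)
    (∀ (i : Fin r) → 0ℤ ℤ.< H (inject≤ i r≤m) (piv i))
  ×
    (∀ (i i' : Fin r) → toℕ i <ℕ toℕ i' → toℕ (piv i) <ℕ toℕ (piv i'))
  ×
    (∀ (k' i : Fin r) → toℕ k' <ℕ toℕ i →
        (0ℤ ℤ.≤ H (inject≤ k' r≤m) (piv i)) × (H (inject≤ k' r≤m) (piv i) ℤ.< H (inject≤ i r≤m) (piv i)))

IsHNFDecomp : ∀ {m k} → ZMat m k → ZMat m m → ZMat m k → Set
IsHNFDecomp Q U H = GL U × IsHNF H × (∀ i j → Q i j ≡ (U ·ℤ H) i j)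

-- The scalars of the forms: a commutative ring with a strict order
-- (instantiated by ℝ with its usual order in the paper).

record OrderedCommRing c ℓ ℓ' : Set (lsuc (c ⊔ ℓ ⊔ ℓ')) where
  field
    commutativeRing : CommutativeRing c ℓ
  open CommutativeRing commutativeRing public
  field
    _<_ : Carrier → Carrier → Set ℓ'
    <-resp-≈ : ∀ {x x' y y'} → x ≈ x' → y ≈ y' → x < y → x' < y'

module Forms {c ℓ ℓ'} (R : OrderedCommRing c ℓ ℓ') where
  open OrderedCommRing R

  Mat : ℕ → Set c
  Mat n = Fin n → Fin n → Carrier

  ∑R : (n : ℕ) → (Fin n → Carrier) → Carrier
  ∑R = ∑ _+_ 0#

  natR : ℕ → Carrier
  natR zero    = 0#
  natR (suc n) = 1# + natR n

  fromℤ : ℤ → Carrier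
  fromℤ (+ n)      = natR n
  fromℤ -[1+ n ]   = - natR (suc n)

  _≈ₘ_ : ∀ {n} → Mat n → Mat n → Set ℓ
  A ≈ₘ B = ∀ i j → A i j ≈ B i j

  act : ∀ {n} → ZMat n n → Mat n → Mat n
  act {n} U A i j = ∑R n (λ k → ∑R n (λ l → (fromℤ (U k i) * A k l) * fromℤ (U l j)))

  Symmetric : ∀ {n} → Mat n → Set ℓ
  Symmetric A = ∀ i j → A i j ≈ A j i

  PosDef : ∀ {n} → Mat n → Set (c ⊔ ℓ ⊔ ℓ')
  PosDef {n} A = ∀ (x : Fin n → Carrier) → ¬ (∀ i → x i ≈ 0#) →
    0# < ∑R n (λ i → ∑R n (λ j → (x i * A i j) * x j))

  Form : ∀ {n} → Mat n → Set (c ⊔ ℓ ⊔ ℓ')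
  Form A = Symmetric A × PosDef A

  Equivalent : ∀ {n} → Mat n → Mat n → Set ℓ
  Equivalent A B = ∃ λ U → GL U × (A ≈ₘ act U B)

  InStab : ∀ {n} → Mat n → ZMat n n → Set ℓ
  InStab A S = GL S × (act S A ≈ₘ A)

  -- V assigns to each form the canonically ordered list (v₁,…,v_p) of V(A).
  IsCharVecFun : (∀ {n} → Mat n → List (Vec ℤ n)) → Set (c ⊔ ℓ ⊔ ℓ')
  IsCharVecFun V =
    ∀ {n} → 1 ≤ℕ n → ∀ (A : Mat n) → Form A →
      Unique (V A)
    × Generates (V A)
    × (∀ U U⁻¹ → IsInverse U U⁻¹ → ∀ w →
         (w Mem.∈ V (act U A)) ⇔ (∃ λ v → v Mem.∈ V A × w ≡ U⁻¹ ·v v))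

  IsCanonicalOrdering : (∀ {n} → Mat n → List (Vec ℤ n)) → Set (c ⊔ ℓ ⊔ ℓ')
  IsCanonicalOrdering V =
    ∀ {n} → 1 ≤ℕ n → ∀ (A : Mat n) → Form A →
      ∀ P P⁻¹ → IsInverse P P⁻¹ →
        ∃ λ S → InStab A S × (V (act P A) ≡ map (λ v → P⁻¹ ·v (S ·v v)) (V A))

-- Let S ∈ Stab(A) be the element supplied by the canonical ordering for P and put
-- M = P⁻¹S, so that Q_{PᵀAP} = M Q_A.  If Q_A = U H is the Hermite decomposition then so
-- is M Q_A = (M U) H, and because Q_A has full rank the left factor of a Hermite
-- decomposition is unique: U_{PᵀAP} = M U.  Hence
-- Can(PᵀAP) = Uᵀ Mᵀ PᵀAP M U = Uᵀ SᵀAS U = Uᵀ A U = Can(A).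
-- For the uniqueness, let H' = W H with W unimodular and H, H' Hermite forms with a pivot
-- in every row.  By induction over k: once the first k columns of W and of W⁻¹ are those
-- of the identity, the k-th pivots of H and H' lie in the same column c, W k k is a
-- positive unit, so both pivots equal some t, and the other entries of column k of W
-- vanish: below the diagonal W i k · t is an entry of H' under a pivot, above it
-- W i k · t is the difference of two entries of column c reduced modulo t.
{-# OPTIONS --safe #-}
module Submission where

open import Defs
open import Data.Nat using (ℕ; _≤_)
open import Data.Integer using (ℤ)
open import Data.Vec using (Vec)
open import Data.List using (List; length)
open import Data.Product using (_×_)

open import Level using (0ℓ)
open import Function using (_∘_)
open import Data.Nat as ℕ using (zero; suc)
import Data.Nat.Properties as ℕ
open import Data.Integer as ℤ using (+_; -[1+_]; 0ℤ; 1ℤ) renaming (_+_ to _+ℤ_; _*_ to _*ℤ_)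
import Data.Integer.Properties as ℤ
open import Data.Integer.Solver using (module +-*-Solver)
open import Data.Fin as Fin using (Fin; cast; fromℕ<) renaming (zero to fzero; suc to fsuc)
open import Data.Fin.Properties using (<-cmp; <⇒≢; suc-injective; cast-is-id; toℕ-fromℕ<; inject≤-refl)
open import Data.Fin.Induction using (<-wellFounded)
open import Induction.WellFounded using (module All)
open import Data.Vec using (lookup; tabulate)
open import Data.Vec.Properties using (lookup∘tabulate; tabulate-cong)
import Data.Vec.Functional.Relation.Binary.Equality.Setoid as Pointwise
import Relation.Binary.Reasoning.Setoid as SetoidReasoning
open import Data.List using (_∷_; map)
open import Data.List.Properties using (length-map; map-cong)
open import Data.Product using (∃; _,_; proj₁; proj₂)
open import Data.Sum using (inj₁; inj₂)
open import Data.Empty using (⊥-elim)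
open import Relation.Nullary using (¬_; yes; no)
open import Relation.Binary using (tri<; tri≈; tri>)
open import Relation.Binary.PropositionalEquality as ≡
  using (_≡_; _≢_; refl; sym; trans; cong; cong₂; subst; subst₂)
open import Algebra.Bundles using (CommutativeRing)
open import Relation.Binary.Bundles using (Setoid)

module FiniteSums {c ℓ} (R : CommutativeRing c ℓ) where
  open CommutativeRing R renaming (refl to ≈-refl; sym to ≈-sym; trans to ≈-trans)
  open import Algebra.Properties.Semiring.Sum semiring as Sum using (sum)
  open import Relation.Binary.Reasoning.Setoid setoid

  ∑R : (n : ℕ) → (Fin n → Carrier) → Carrier
  ∑R = ∑ _+_ 0#

  ∑R≈sum : ∀ n (f : Fin n → Carrier) → ∑R n f ≈ sum f
  ∑R≈sum zero    f = ≈-refl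
  ∑R≈sum (suc n) f = +-congˡ (∑R≈sum n (f ∘ fsuc))

  ∑-cong : ∀ n {f g : Fin n → Carrier} → (∀ i → f i ≈ g i) → ∑R n f ≈ ∑R n g
  ∑-cong n {f} {g} f≈g = begin
    ∑R n f ≈⟨ ∑R≈sum n f ⟩
    sum f  ≈⟨ Sum.sum-cong-≋ f≈g ⟩
    sum g  ≈⟨ ∑R≈sum n g ⟨
    ∑R n g ∎

  ∑-zero : ∀ n {f : Fin n → Carrier} → (∀ i → f i ≈ 0#) → ∑R n f ≈ 0#
  ∑-zero n f≈0 = ≈-trans (∑-cong n f≈0) (≈-trans (∑R≈sum n _) (Sum.sum-replicate-zero n))

  *-distribˡ-∑ : ∀ n x (f : Fin n → Carrier) → x * ∑R n f ≈ ∑R n (λ i → x * f i)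
  *-distribˡ-∑ n x f = begin
    x * ∑R n f            ≈⟨ *-congˡ (∑R≈sum n f) ⟩
    x * sum f             ≈⟨ Sum.*-distribˡ-sum x f ⟩
    sum (λ i → x * f i)   ≈⟨ ∑R≈sum n _ ⟨
    ∑R n (λ i → x * f i)  ∎

  *-distribʳ-∑ : ∀ n x (f : Fin n → Carrier) → ∑R n f * x ≈ ∑R n (λ i → f i * x)
  *-distribʳ-∑ n x f = begin
    ∑R n f * x            ≈⟨ *-congʳ (∑R≈sum n f) ⟩
    sum f * x             ≈⟨ Sum.*-distribʳ-sum x f ⟩
    sum (λ i → f i * x)   ≈⟨ ∑R≈sum n _ ⟨
    ∑R n (λ i → f i * x)  ∎

  ∑-comm : ∀ m n (f : Fin m → Fin n → Carrier) →
    ∑R m (λ i → ∑R n (f i)) ≈ ∑R n (λ j → ∑R m (λ i → f i j))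
  ∑-comm m n f = begin
    ∑R m (λ i → ∑R n (f i))          ≈⟨ ∑-cong m (λ i → ∑R≈sum n (f i)) ⟩
    ∑R m (λ i → sum (f i))           ≈⟨ ∑R≈sum m _ ⟩
    sum (λ i → sum (f i))            ≈⟨ Sum.∑-comm f ⟩
    sum (λ j → sum (λ i → f i j))    ≈⟨ ∑R≈sum n _ ⟨
    ∑R n (λ j → sum (λ i → f i j))   ≈⟨ ∑-cong n (λ j → ∑R≈sum m _) ⟨
    ∑R n (λ j → ∑R m (λ i → f i j))  ∎

  ∑∑-comm : ∀ m n (F : Fin m → Fin m → Fin n → Fin n → Carrier) →
    ∑R m (λ k → ∑R m (λ l → ∑R n (λ a → ∑R n (F k l a)))) ≈
    ∑R n (λ a → ∑R n (λ b → ∑R m (λ k → ∑R m (λ l → F k l a b))))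
  ∑∑-comm m n F = begin
    ∑R m (λ k → ∑R m (λ l → ∑R n (λ a → ∑R n (F k l a))))           ≈⟨ ∑-cong m (λ k → ∑-comm m n _) ⟩
    ∑R m (λ k → ∑R n (λ a → ∑R m (λ l → ∑R n (F k l a))))           ≈⟨ ∑-comm m n _ ⟩
    ∑R n (λ a → ∑R m (λ k → ∑R m (λ l → ∑R n (F k l a))))           ≈⟨ ∑-cong n (λ a → ∑-cong m (λ k → ∑-comm m n _)) ⟩
    ∑R n (λ a → ∑R m (λ k → ∑R n (λ b → ∑R m (λ l → F k l a b))))   ≈⟨ ∑-cong n (λ a → ∑-comm m n _) ⟩
    ∑R n (λ a → ∑R n (λ b → ∑R m (λ k → ∑R m (λ l → F k l a b))))   ∎

  ∑-single : ∀ n (a : Fin n) (f : Fin n → Carrier) → (∀ l → l ≢ a → f l ≈ 0#) → ∑R n f ≈ f a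
  ∑-single (suc n) fzero    f f≈0 = ≈-trans (+-congˡ (∑-zero n (λ l → f≈0 (fsuc l) λ ()))) (+-identityʳ _)
  ∑-single (suc n) (fsuc a) f f≈0 =
    ≈-trans (+-cong (f≈0 fzero λ ()) (∑-single n a (f ∘ fsuc) λ l l≢a → f≈0 (fsuc l) (l≢a ∘ suc-injective)))
            (+-identityˡ _)

  ∑-pair : ∀ n (a b : Fin n) (f : Fin n → Carrier) → a ≢ b →
    (∀ l → l ≢ a → l ≢ b → f l ≈ 0#) → ∑R n f ≈ f a + f b
  ∑-pair (suc n) fzero    fzero    f a≢b _   = ⊥-elim (a≢b refl)
  ∑-pair (suc n) fzero    (fsuc b) f _   f≈0 =
    +-congˡ (∑-single n b (f ∘ fsuc) λ l l≢b → f≈0 (fsuc l) (λ ()) (l≢b ∘ suc-injective))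
  ∑-pair (suc n) (fsuc a) fzero    f _   f≈0 =
    ≈-trans (+-congˡ (∑-single n a (f ∘ fsuc) λ l l≢a → f≈0 (fsuc l) (l≢a ∘ suc-injective) (λ ()))) (+-comm _ _)
  ∑-pair (suc n) (fsuc a) (fsuc b) f a≢b f≈0 =
    ≈-trans (+-cong (f≈0 fzero (λ ()) (λ ()))
                    (∑-pair n a b (f ∘ fsuc) (a≢b ∘ cong fsuc)
                            λ l l≢a l≢b → f≈0 (fsuc l) (l≢a ∘ suc-injective) (l≢b ∘ suc-injective)))
            (+-identityˡ _)

  ∑-mul-assoc : ∀ k k' (a : Fin k → Carrier) (B : Fin k → Fin k' → Carrier) (c : Fin k' → Carrier) →
    ∑R k' (λ l → ∑R k (λ m → a m * B m l) * c l) ≈ ∑R k (λ m → a m * ∑R k' (λ l → B m l * c l))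
  ∑-mul-assoc k k' a B c = begin
    ∑R k' (λ l → ∑R k (λ m → a m * B m l) * c l)   ≈⟨ ∑-cong k' (λ l → *-distribʳ-∑ k (c l) _) ⟩
    ∑R k' (λ l → ∑R k (λ m → (a m * B m l) * c l)) ≈⟨ ∑-comm k' k _ ⟩
    ∑R k (λ m → ∑R k' (λ l → (a m * B m l) * c l)) ≈⟨ ∑-cong k (λ m → ∑-cong k' (λ l → *-assoc _ _ _)) ⟩
    ∑R k (λ m → ∑R k' (λ l → a m * (B m l * c l))) ≈⟨ ∑-cong k (λ m → *-distribˡ-∑ k' (a m) _) ⟨
    ∑R k (λ m → a m * ∑R k' (λ l → B m l * c l))   ∎

open FiniteSums ℤ.+-*-commutativeRing using ()
  renaming (∑-cong to ∑ℤ-cong; ∑-zero to ∑ℤ-zero; ∑-single to ∑ℤ-single; ∑-pair to ∑ℤ-pair;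
            ∑-comm to ∑ℤ-comm; *-distribˡ-∑ to *-distribˡ-∑ℤ; ∑-mul-assoc to ∑ℤ-mul-assoc)

infix 4 _≗ₘ_
_≗ₘ_ : ∀ {m n} → ZMat m n → ZMat m n → Set
X ≗ₘ Y = ∀ i j → X i j ≡ Y i j

idℤ-diag : ∀ {n} (i : Fin n) → idℤ i i ≡ 1ℤ
idℤ-diag i with i Fin.≟ i
... | yes _   = refl
... | no i≢i = ⊥-elim (i≢i refl)

idℤ-offDiag : ∀ {n} {i j : Fin n} → i ≢ j → idℤ i j ≡ 0ℤ
idℤ-offDiag {i = i} {j} i≢j with i Fin.≟ j
... | yes i≡j = ⊥-elim (i≢j i≡j)
... | no _    = refl

·-assoc : ∀ {m k k' n} (X : ZMat m k) (Y : ZMat k k') (Z : ZMat k' n) → (X ·ℤ Y) ·ℤ Z ≗ₘ X ·ℤ (Y ·ℤ Z)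
·-assoc {k = k} {k'} X Y Z i j = ∑ℤ-mul-assoc k k' (X i) Y (λ l → Z l j)

·-identityˡ : ∀ {m n} (X : ZMat m n) → idℤ ·ℤ X ≗ₘ X
·-identityˡ {m} X i j = begin
  (idℤ ·ℤ X) i j    ≡⟨ ∑ℤ-single m i _ (λ l l≢i → cong (_*ℤ X l j) (idℤ-offDiag (l≢i ∘ sym))) ⟩
  idℤ i i *ℤ X i j  ≡⟨ cong (_*ℤ X i j) (idℤ-diag i) ⟩
  1ℤ *ℤ X i j       ≡⟨ ℤ.*-identityˡ (X i j) ⟩
  X i j             ∎
  where open ≡.≡-Reasoning

·-identityʳ : ∀ {m n} (X : ZMat m n) → X ·ℤ idℤ ≗ₘ X
·-identityʳ {n = n} X i j = begin
  (X ·ℤ idℤ) i j    ≡⟨ ∑ℤ-single n j _ (λ l l≢j → trans (cong (X i l *ℤ_) (idℤ-offDiag l≢j)) (ℤ.*-zeroʳ (X i l))) ⟩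
  X i j *ℤ idℤ j j  ≡⟨ cong (X i j *ℤ_) (idℤ-diag j) ⟩
  X i j *ℤ 1ℤ       ≡⟨ ℤ.*-identityʳ (X i j) ⟩
  X i j             ∎
  where open ≡.≡-Reasoning

·-congˡ : ∀ {m k n} (X : ZMat m k) {Y Z : ZMat k n} → Y ≗ₘ Z → X ·ℤ Y ≗ₘ X ·ℤ Z
·-congˡ {k = k} X Y≗Z i j = ∑ℤ-cong k (λ l → cong (X i l *ℤ_) (Y≗Z l j))

·-congʳ : ∀ {m k n} {X Y : ZMat m k} (Z : ZMat k n) → X ≗ₘ Y → X ·ℤ Z ≗ₘ Y ·ℤ Z
·-congʳ {k = k} Z X≗Y i j = ∑ℤ-cong k (λ l → cong (_*ℤ Z l j) (X≗Y i l))

·-cancelˡ : ∀ {m n} (Y X : ZMat m m) → Y ·ℤ X ≗ₘ idℤ → (Z : ZMat m n) → Y ·ℤ (X ·ℤ Z) ≗ₘ Z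
·-cancelˡ Y X YX≗I Z i j = begin
  (Y ·ℤ (X ·ℤ Z)) i j  ≡⟨ ·-assoc Y X Z i j ⟨
  ((Y ·ℤ X) ·ℤ Z) i j  ≡⟨ ·-congʳ Z YX≗I i j ⟩
  (idℤ ·ℤ Z) i j       ≡⟨ ·-identityˡ Z i j ⟩
  Z i j                ∎
  where open ≡.≡-Reasoning

inverse-sym : ∀ {n} (X Y : ZMat n n) → IsInverse X Y → IsInverse Y X
inverse-sym X Y (XY≗I , YX≗I) = YX≗I , XY≗I

inverse-· : ∀ {n} (X X⁻¹ Y Y⁻¹ : ZMat n n) → IsInverse X X⁻¹ → IsInverse Y Y⁻¹ →
  IsInverse (X ·ℤ Y) (Y⁻¹ ·ℤ X⁻¹)
inverse-· X X⁻¹ Y Y⁻¹ (XX⁻¹ , X⁻¹X) (YY⁻¹ , Y⁻¹Y) =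
  product-inverse X X⁻¹ Y Y⁻¹ XX⁻¹ YY⁻¹ , product-inverse Y⁻¹ Y X⁻¹ X Y⁻¹Y X⁻¹X
  where
  product-inverse : ∀ A A⁻¹ B B⁻¹ → A ·ℤ A⁻¹ ≗ₘ idℤ → B ·ℤ B⁻¹ ≗ₘ idℤ → (A ·ℤ B) ·ℤ (B⁻¹ ·ℤ A⁻¹) ≗ₘ idℤ
  product-inverse A A⁻¹ B B⁻¹ AA⁻¹ BB⁻¹ i j = begin
    ((A ·ℤ B) ·ℤ (B⁻¹ ·ℤ A⁻¹)) i j  ≡⟨ ·-assoc A B (B⁻¹ ·ℤ A⁻¹) i j ⟩
    (A ·ℤ (B ·ℤ (B⁻¹ ·ℤ A⁻¹))) i j  ≡⟨ ·-congˡ A (·-cancelˡ B B⁻¹ BB⁻¹ A⁻¹) i j ⟩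
    (A ·ℤ A⁻¹) i j                  ≡⟨ AA⁻¹ i j ⟩
    idℤ i j                         ∎
    where open ≡.≡-Reasoning

·v-assoc : ∀ {m k n} (X : ZMat m k) (Y : ZMat k n) (v : Vec ℤ n) → (X ·ℤ Y) ·v v ≡ X ·v (Y ·v v)
·v-assoc {k = k} {n} X Y v = tabulate-cong λ i → begin
  ∑ℤ n (λ j → (X ·ℤ Y) i j *ℤ lookup v j)                 ≡⟨ ∑ℤ-mul-assoc k n (X i) Y (lookup v) ⟩
  ∑ℤ k (λ l → X i l *ℤ ∑ℤ n (λ j → Y l j *ℤ lookup v j))  ≡⟨ ∑ℤ-cong k (λ l → cong (X i l *ℤ_) (lookup∘tabulate _ l)) ⟨
  ∑ℤ k (λ l → X i l *ℤ lookup (Y ·v v) l)                 ∎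
  where open ≡.≡-Reasoning

*-cancelʳ-pos : ∀ x y {t} → 0ℤ ℤ.< t → x *ℤ t ≡ y *ℤ t → x ≡ y
*-cancelʳ-pos x y t>0 = ℤ.*-cancelʳ-≡ x y _ {{ℤ.>-nonZero t>0}}

positive-unit : ∀ {x} y → 0ℤ ℤ.< x → y *ℤ x ≡ 1ℤ → x ≡ 1ℤ
positive-unit {+ zero}  y (ℤ.+<+ ()) _
positive-unit {+ suc k} y _ yx≡1 =
  cong +_ (ℕ.m*n≡1⇒n≡1 ℤ.∣ y ∣ (suc k) (trans (sym (ℤ.abs-* y (+ suc k))) (cong ℤ.∣_∣ yx≡1)))

mutual-multiples⇒unit : ∀ {t t'} x y → 0ℤ ℤ.< t → 0ℤ ℤ.< t' → t' ≡ x *ℤ t → t ≡ y *ℤ t' → x ≡ 1ℤ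
mutual-multiples⇒unit {t} x y t>0 t'>0 t'≡xt t≡yt' = positive-unit y x>0 yx≡1
  where
  yx≡1 : y *ℤ x ≡ 1ℤ
  yx≡1 = *-cancelʳ-pos (y *ℤ x) 1ℤ t>0
    (trans (ℤ.*-assoc y x t) (trans (cong (y *ℤ_) (sym t'≡xt)) (trans (sym t≡yt') (sym (ℤ.*-identityˡ t)))))
  x>0 : 0ℤ ℤ.< x
  x>0 = ℤ.*-cancelʳ-<-nonNeg t {{ℤ.nonNegative (ℤ.<⇒≤ t>0)}} (subst₂ ℤ._<_ (sym (ℤ.*-zeroˡ t)) t'≡xt t'>0)

+-pos-multiple-≮ : ∀ {a t} x → 0ℤ ℤ.≤ a → 0ℤ ℤ.< t → 0ℤ ℤ.< x → ¬ (a +ℤ x *ℤ t ℤ.< t)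
+-pos-multiple-≮ {a} {t} x a≥0 t>0 x>0 = ℤ.≤⇒≯ (begin
  t            ≡⟨ ℤ.+-identityˡ t ⟨
  0ℤ +ℤ t      ≤⟨ ℤ.+-mono-≤ a≥0 t≤xt ⟩
  a +ℤ x *ℤ t  ∎)
  where
  open ℤ.≤-Reasoning
  t≤xt : t ℤ.≤ x *ℤ t
  t≤xt = subst (ℤ._≤ x *ℤ t) (ℤ.*-identityˡ t)
           (ℤ.*-monoʳ-≤-nonNeg t {{ℤ.nonNegative (ℤ.<⇒≤ t>0)}} (ℤ.i<j⇒suc[i]≤j x>0))

reduced-residues⇒quotient≡0 : ∀ {a b t} x → 0ℤ ℤ.≤ a → a ℤ.< t → 0ℤ ℤ.≤ b → b ℤ.< t →
  b ≡ a +ℤ x *ℤ t → x ≡ 0ℤ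
reduced-residues⇒quotient≡0 {a} {b} {t} x a≥0 a<t b≥0 b<t b≡a+xt with ℤ.<-cmp x 0ℤ
... | tri≈ _ x≡0 _ = x≡0
... | tri> _ _ x>0 =
  ⊥-elim (+-pos-multiple-≮ x a≥0 (ℤ.≤-<-trans b≥0 b<t) x>0 (subst (ℤ._< t) b≡a+xt b<t))
... | tri< x<0 _ _ =
  ⊥-elim (+-pos-multiple-≮ (ℤ.- x) b≥0 (ℤ.≤-<-trans a≥0 a<t) (ℤ.neg-mono-< x<0) (subst (ℤ._< t) a≡b-xt a<t))
  where
  open +-*-Solver
  a≡b-xt : a ≡ b +ℤ ℤ.- x *ℤ t
  a≡b-xt rewrite b≡a+xt = solve 3 (λ a x t → a := (a :+ x :* t) :+ :- x :* t) refl a x t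

NoZeroRow : ∀ {m k} → ZMat m k → Set
NoZeroRow H = ∀ i → ¬ (∀ j → H i j ≡ 0ℤ)

record FullRankHNF {n p} (H : ZMat n p) (piv : Fin n → Fin p) : Set where
  field
    zero-before-pivot   : ∀ i j → j Fin.< piv i → H i j ≡ 0ℤ
    pivot-positive      : ∀ i → 0ℤ ℤ.< H i (piv i)
    pivot-increasing    : ∀ i i' → i Fin.< i' → piv i Fin.< piv i'
    above-pivot-reduced : ∀ k i → k Fin.< i → (0ℤ ℤ.≤ H k (piv i)) × (H k (piv i) ℤ.< H i (piv i))

  zero-below-pivot : ∀ l k → k Fin.< l → H l (piv k) ≡ 0ℤ
  zero-below-pivot l k k<l = zero-before-pivot l (piv k) (pivot-increasing k l k<l)

isHNF⇒fullRank : ∀ {n p} {H : ZMat n p} → IsHNF H → NoZeroRow H → ∃ (FullRankHNF H)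
isHNF⇒fullRank {H = H} (r , r≤n , piv , zero-rows , zero-before , positive , increasing , reduced) noZero
  with ℕ.m≤n⇒m<n∨m≡n r≤n
... | inj₁ r<n = ⊥-elim (noZero (fromℕ< r<n) (zero-rows (fromℕ< r<n) (ℕ.≤-reflexive (sym (toℕ-fromℕ< r<n)))))
... | inj₂ refl = piv , record
  { zero-before-pivot   = λ i j j<p → subst (λ i′ → H i′ j ≡ 0ℤ) (inject≤-refl i r≤n) (zero-before i j j<p)
  ; pivot-positive      = λ i → subst (λ i′ → 0ℤ ℤ.< H i′ (piv i)) (inject≤-refl i r≤n) (positive i)
  ; pivot-increasing    = increasing
  ; above-pivot-reduced = λ k i k<i →
      subst₂ (λ k′ i′ → (0ℤ ℤ.≤ H k′ (piv i)) × (H k′ (piv i) ℤ.< H i′ (piv i)))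
             (inject≤-refl k r≤n) (inject≤-refl i r≤n) (reduced k i k<i)
  }

fin-strong-induction : ∀ {n} (P : Fin n → Set) → (∀ k → (∀ {k'} → k' Fin.< k → P k') → P k) → ∀ k → P k
fin-strong-induction = All.wfRec <-wellFounded 0ℓ

fullRank-leftKernel : ∀ {n p} {H : ZMat n p} {piv} → FullRankHNF H piv → (y : Fin n → ℤ) →
  (∀ j → ∑ℤ n (λ l → y l *ℤ H l j) ≡ 0ℤ) → ∀ k → y k ≡ 0ℤ
fullRank-leftKernel {n} {H = H} {piv} F y yH≡0 = fin-strong-induction (λ k → y k ≡ 0ℤ) step
  where
  open FullRankHNF F
  step : ∀ k → (∀ {k'} → k' Fin.< k → y k' ≡ 0ℤ) → y k ≡ 0ℤ
  step k earlier = *-cancelʳ-pos (y k) 0ℤ (pivot-positive k)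
    (trans (sym (∑ℤ-single n k _ other-term)) (trans (yH≡0 (piv k)) (sym (ℤ.*-zeroˡ (H k (piv k))))))
    where
    other-term : ∀ l → l ≢ k → y l *ℤ H l (piv k) ≡ 0ℤ
    other-term l l≢k with <-cmp l k
    ... | tri< l<k _ _ = trans (cong (_*ℤ H l (piv k)) (earlier l<k)) (ℤ.*-zeroˡ (H l (piv k)))
    ... | tri≈ _ l≡k _ = ⊥-elim (l≢k l≡k)
    ... | tri> _ _ k<l = trans (cong (y l *ℤ_) (zero-below-pivot l k k<l)) (ℤ.*-zeroʳ (y l))

noZeroRow-leftMul : ∀ {n p} {H : ZMat n p} {piv} → FullRankHNF H piv → (W W⁻¹ : ZMat n n) (H' : ZMat n p) →
  IsInverse W W⁻¹ → H' ≗ₘ W ·ℤ H → NoZeroRow H'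
noZeroRow-leftMul {n} F W W⁻¹ H' (WW⁻¹ , _) H'≗WH i row-zero = 1≢0 (begin
  1ℤ                             ≡⟨ idℤ-diag i ⟨
  idℤ i i                        ≡⟨ WW⁻¹ i i ⟨
  ∑ℤ n (λ l → W i l *ℤ W⁻¹ l i)  ≡⟨ ∑ℤ-zero n (λ l → trans (cong (_*ℤ W⁻¹ l i) (row-W-zero l)) (ℤ.*-zeroˡ (W⁻¹ l i))) ⟩
  0ℤ                             ∎)
  where
  open ≡.≡-Reasoning
  row-W-zero : ∀ l → W i l ≡ 0ℤ
  row-W-zero = fullRank-leftKernel F (W i) (λ j → trans (sym (H'≗WH i j)) (row-zero j))
  1≢0 : 1ℤ ≢ 0ℤ
  1≢0 ()

IdentityColumn : ∀ {n} → ZMat n n → Fin n → Set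
IdentityColumn W k = ∀ i → W i k ≡ idℤ i k

IdentityBefore : ∀ {n} → ZMat n n → Fin n → Set
IdentityBefore W k = ∀ {k'} → k' Fin.< k → IdentityColumn W k'

module PivotColumn {n p} {H H' : ZMat n p} {piv} (F : FullRankHNF H piv) {W : ZMat n n}
                   (H'≗WH : H' ≗ₘ W ·ℤ H) {k : Fin n} (identity-before : IdentityBefore W k) where
  open FullRankHNF F

  earlier-term : ∀ {i l} x → l Fin.< k → l ≢ i → W i l *ℤ x ≡ 0ℤ
  earlier-term {i} x l<k l≢i =
    trans (cong (_*ℤ x) (trans (identity-before l<k i) (idℤ-offDiag (l≢i ∘ sym)))) (ℤ.*-zeroˡ x)

  later-term : ∀ {i l} → k Fin.< l → W i l *ℤ H l (piv k) ≡ 0ℤ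
  later-term {i} {l} k<l = trans (cong (W i l *ℤ_) (zero-below-pivot l k k<l)) (ℤ.*-zeroʳ (W i l))

  zero-before-pivot′ : ∀ j → j Fin.< piv k → H' k j ≡ 0ℤ
  zero-before-pivot′ j j<piv = trans (H'≗WH k j) (∑ℤ-zero n term)
    where
    term : ∀ l → W k l *ℤ H l j ≡ 0ℤ
    term l with <-cmp l k
    ... | tri< l<k _ _  = earlier-term (H l j) l<k (<⇒≢ l<k)
    ... | tri≈ _ refl _ = trans (cong (W k k *ℤ_) (zero-before-pivot k j j<piv)) (ℤ.*-zeroʳ (W k k))
    ... | tri> _ _ k<l  =
      trans (cong (W k l *ℤ_) (zero-before-pivot l j (ℕ.<-trans j<piv (pivot-increasing k l k<l)))) (ℤ.*-zeroʳ (W k l))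

  pivot-column-below : ∀ i → k Fin.≤ i → H' i (piv k) ≡ W i k *ℤ H k (piv k)
  pivot-column-below i k≤i = trans (H'≗WH i (piv k)) (∑ℤ-single n k _ term)
    where
    term : ∀ l → l ≢ k → W i l *ℤ H l (piv k) ≡ 0ℤ
    term l l≢k with <-cmp l k
    ... | tri< l<k _ _ = earlier-term _ l<k (<⇒≢ (ℕ.<-≤-trans l<k k≤i))
    ... | tri≈ _ l≡k _ = ⊥-elim (l≢k l≡k)
    ... | tri> _ _ k<l = later-term k<l

  pivot-column-above : ∀ i → i Fin.< k → H' i (piv k) ≡ H i (piv k) +ℤ W i k *ℤ H k (piv k)
  pivot-column-above i i<k = begin
    H' i (piv k)                                  ≡⟨ H'≗WH i (piv k) ⟩
    ∑ℤ n (λ l → W i l *ℤ H l (piv k))             ≡⟨ ∑ℤ-pair n i k _ (<⇒≢ i<k) term ⟩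
    W i i *ℤ H i (piv k) +ℤ W i k *ℤ H k (piv k)  ≡⟨ cong (λ w → w *ℤ H i (piv k) +ℤ W i k *ℤ H k (piv k)) W-ii ⟩
    1ℤ *ℤ H i (piv k) +ℤ W i k *ℤ H k (piv k)     ≡⟨ cong (_+ℤ W i k *ℤ H k (piv k)) (ℤ.*-identityˡ (H i (piv k))) ⟩
    H i (piv k) +ℤ W i k *ℤ H k (piv k)           ∎
    where
    open ≡.≡-Reasoning
    W-ii : W i i ≡ 1ℤ
    W-ii = trans (identity-before i<k i) (idℤ-diag i)
    term : ∀ l → l ≢ i → l ≢ k → W i l *ℤ H l (piv k) ≡ 0ℤ
    term l l≢i l≢k with <-cmp l k
    ... | tri< l<k _ _ = earlier-term _ l<k l≢i
    ... | tri≈ _ l≡k _ = ⊥-elim (l≢k l≡k)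
    ... | tri> _ _ k<l = later-term k<l

module LeftFactorColumn {n p} {H H' : ZMat n p} {piv piv'} (F : FullRankHNF H piv) (F' : FullRankHNF H' piv')
                        {W V : ZMat n n} (H'≗WH : H' ≗ₘ W ·ℤ H) (H≗VH' : H ≗ₘ V ·ℤ H')
                        {k : Fin n} (W-before : IdentityBefore W k) (V-before : IdentityBefore V k) where
  private
    module F  = FullRankHNF F
    module F' = FullRankHNF F'
    module Wk = PivotColumn F H'≗WH W-before
    module Vk = PivotColumn F' H≗VH' V-before

  pivots-agree : piv' k ≡ piv k
  pivots-agree with <-cmp (piv' k) (piv k)
  ... | tri< p'<p _ _ = ⊥-elim (ℤ.<-irrefl (sym (Wk.zero-before-pivot′ (piv' k) p'<p)) (F'.pivot-positive k))
  ... | tri≈ _ p'≡p _ = p'≡p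
  ... | tri> _ _ p<p' = ⊥-elim (ℤ.<-irrefl (sym (Vk.zero-before-pivot′ (piv k) p<p')) (F.pivot-positive k))

  private
    c : Fin p
    c = piv k

    t t' : ℤ
    t  = H k c
    t' = H' k c

    at-pivot : ∀ {P : Fin p → Set} → P (piv' k) → P c
    at-pivot {P} = subst P pivots-agree

    t'≡Wkk*t : t' ≡ W k k *ℤ t
    t'≡Wkk*t = Wk.pivot-column-below k ℕ.≤-refl

    Wkk≡1 : W k k ≡ 1ℤ
    Wkk≡1 = mutual-multiples⇒unit (W k k) (V k k) (F.pivot-positive k)
              (at-pivot {λ c → 0ℤ ℤ.< H' k c} (F'.pivot-positive k)) t'≡Wkk*t
              (at-pivot {λ c → H k c ≡ V k k *ℤ H' k c} (Vk.pivot-column-below k ℕ.≤-refl))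

    t'≡t : t' ≡ t
    t'≡t = trans t'≡Wkk*t (trans (cong (_*ℤ t) Wkk≡1) (ℤ.*-identityˡ t))

  identity-column : IdentityColumn W k
  identity-column i with <-cmp i k
  ... | tri≈ _ refl _ = trans Wkk≡1 (sym (idℤ-diag k))
  ... | tri> _ _ k<i  =
    trans (*-cancelʳ-pos (W i k) 0ℤ (F.pivot-positive k) Wik*t≡0*t) (sym (idℤ-offDiag (<⇒≢ k<i ∘ sym)))
    where
    Wik*t≡0*t : W i k *ℤ t ≡ 0ℤ *ℤ t
    Wik*t≡0*t = trans (sym (Wk.pivot-column-below i (ℕ.<⇒≤ k<i)))
                  (trans (at-pivot {λ c → H' i c ≡ 0ℤ} (F'.zero-below-pivot i k k<i)) (sym (ℤ.*-zeroˡ t)))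
  ... | tri< i<k _ _  =
    trans (reduced-residues⇒quotient≡0 (W i k) (proj₁ reduced) (proj₂ reduced)
                                         (proj₁ reduced′) (subst (H' i c ℤ.<_) t'≡t (proj₂ reduced′))
                                         (Wk.pivot-column-above i i<k))
          (sym (idℤ-offDiag (<⇒≢ i<k)))
    where
    reduced : (0ℤ ℤ.≤ H i c) × (H i c ℤ.< t)
    reduced = F.above-pivot-reduced i k i<k
    reduced′ : (0ℤ ℤ.≤ H' i c) × (H' i c ℤ.< t')
    reduced′ = at-pivot {λ c → (0ℤ ℤ.≤ H' i c) × (H' i c ℤ.< H' k c)} (F'.above-pivot-reduced i k i<k)

fullRank-leftFactor-identity : ∀ {n p} {H H' : ZMat n p} {piv piv'} → FullRankHNF H piv → FullRankHNF H' piv' →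
  (W V : ZMat n n) → H' ≗ₘ W ·ℤ H → H ≗ₘ V ·ℤ H' → W ≗ₘ idℤ
fullRank-leftFactor-identity F F' W V H'≗WH H≗VH' i k = proj₁ (fin-strong-induction P step k) i
  where
  P : Fin _ → Set
  P k = IdentityColumn W k × IdentityColumn V k
  step : ∀ k → (∀ {k'} → k' Fin.< k → P k') → P k
  step k earlier = LeftFactorColumn.identity-column F F' H'≗WH H≗VH' (proj₁ ∘ earlier) (proj₂ ∘ earlier)
                 , LeftFactorColumn.identity-column F' F H≗VH' H'≗WH (proj₂ ∘ earlier) (proj₁ ∘ earlier)

leftFactor-identity : ∀ {n p} {H H' : ZMat n p} → IsHNF H → IsHNF H' → NoZeroRow H →
  (W W⁻¹ : ZMat n n) → IsInverse W W⁻¹ → H' ≗ₘ W ·ℤ H → W ≗ₘ idℤ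
leftFactor-identity {H = H} {H'} hnf hnf' noZero W W⁻¹ W-inv H'≗WH with isHNF⇒fullRank hnf noZero
... | _ , F with isHNF⇒fullRank hnf' (noZeroRow-leftMul F W W⁻¹ H' W-inv H'≗WH)
... | _ , F' = fullRank-leftFactor-identity F F' W W⁻¹ H'≗WH H≗W⁻¹H'
  where
  H≗W⁻¹H' : H ≗ₘ W⁻¹ ·ℤ H'
  H≗W⁻¹H' i j = trans (sym (·-cancelˡ W⁻¹ W (proj₂ W-inv) H i j)) (sym (·-congˡ W⁻¹ H'≗WH i j))

hnfDecomp-unique : ∀ {n p} {Q : ZMat n p} (U U' : ZMat n n) (H H' : ZMat n p) →
  IsHNFDecomp Q U H → IsHNFDecomp Q U' H' → NoZeroRow H → U' ≗ₘ U
hnfDecomp-unique U U' H H' ((U⁻¹ , U-inv) , hnf , Q≗UH) ((U'⁻¹ , U'-inv) , hnf' , Q≗U'H') noZero i j = begin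
  U' i j                   ≡⟨ ·-identityʳ U' i j ⟨
  (U' ·ℤ idℤ) i j          ≡⟨ ·-congˡ U' W≗I i j ⟨
  (U' ·ℤ (U'⁻¹ ·ℤ U)) i j  ≡⟨ ·-cancelˡ U' U'⁻¹ (proj₁ U'-inv) U i j ⟩
  U i j                    ∎
  where
  open ≡.≡-Reasoning
  H'≗WH : H' ≗ₘ (U'⁻¹ ·ℤ U) ·ℤ H
  H'≗WH a b = begin
    H' a b                   ≡⟨ ·-cancelˡ U'⁻¹ U' (proj₂ U'-inv) H' a b ⟨
    (U'⁻¹ ·ℤ (U' ·ℤ H')) a b ≡⟨ ·-congˡ U'⁻¹ (λ x y → trans (sym (Q≗U'H' x y)) (Q≗UH x y)) a b ⟩
    (U'⁻¹ ·ℤ (U ·ℤ H)) a b   ≡⟨ ·-assoc U'⁻¹ U H a b ⟨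
    ((U'⁻¹ ·ℤ U) ·ℤ H) a b   ∎
  W≗I : U'⁻¹ ·ℤ U ≗ₘ idℤ
  W≗I = leftFactor-identity hnf hnf' noZero (U'⁻¹ ·ℤ U) (U⁻¹ ·ℤ U')
          (inverse-· U'⁻¹ U' U U⁻¹ (inverse-sym U' U'⁻¹ U'-inv) U-inv) H'≗WH

generators-annihilated : ∀ {n} (vs : List (Vec ℤ n)) → Generates vs → (y : Fin n → ℤ) →
  (∀ j → ∑ℤ n (λ a → y a *ℤ colMat vs a j) ≡ 0ℤ) → ∀ w → ∑ℤ n (λ a → y a *ℤ lookup w a) ≡ 0ℤ
generators-annihilated {n} vs generates y y·vⱼ≡0 w = begin
  ∑ℤ n (λ a → y a *ℤ lookup w a)                            ≡⟨ ∑ℤ-cong n (λ a → cong (y a *ℤ_) (proj₂ (generates w) a)) ⟩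
  ∑ℤ n (λ a → y a *ℤ ∑ℤ p (λ j → cw j *ℤ colMat vs a j))    ≡⟨ ∑ℤ-cong n (λ a → *-distribˡ-∑ℤ p (y a) _) ⟩
  ∑ℤ n (λ a → ∑ℤ p (λ j → y a *ℤ (cw j *ℤ colMat vs a j)))  ≡⟨ ∑ℤ-comm n p _ ⟩
  ∑ℤ p (λ j → ∑ℤ n (λ a → y a *ℤ (cw j *ℤ colMat vs a j)))  ≡⟨ ∑ℤ-cong p (λ j → ∑ℤ-cong n (λ a → swap-factors (y a) (cw j) _)) ⟩
  ∑ℤ p (λ j → ∑ℤ n (λ a → cw j *ℤ (y a *ℤ colMat vs a j)))  ≡⟨ ∑ℤ-cong p (λ j → *-distribˡ-∑ℤ n (cw j) _) ⟨
  ∑ℤ p (λ j → cw j *ℤ ∑ℤ n (λ a → y a *ℤ colMat vs a j))    ≡⟨ ∑ℤ-zero p (λ j → trans (cong (cw j *ℤ_) (y·vⱼ≡0 j)) (ℤ.*-zeroʳ (cw j))) ⟩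
  0ℤ                                                        ∎
  where
  open ≡.≡-Reasoning
  p : ℕ
  p = length vs
  cw : Fin p → ℤ
  cw = proj₁ (generates w)
  swap-factors : ∀ a b c → a *ℤ (b *ℤ c) ≡ b *ℤ (a *ℤ c)
  swap-factors a b c = trans (sym (ℤ.*-assoc a b c)) (trans (cong (_*ℤ c) (ℤ.*-comm a b)) (ℤ.*-assoc b a c))

-- A zero row i of H makes row i of U⁻¹ annihilate the columns, hence all of ℤⁿ, yet it
-- pairs to 1 with column i of U.
generates⇒noZeroRow : ∀ {n} (vs : List (Vec ℤ n)) → Generates vs → (U : ZMat n n) (H : ZMat n (length vs)) →
  IsHNFDecomp (colMat vs) U H → NoZeroRow H
generates⇒noZeroRow {n} vs generates U H ((U⁻¹ , _ , U⁻¹U) , _ , Q≗UH) i row-zero = 1≢0 (begin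
  1ℤ                                            ≡⟨ idℤ-diag i ⟨
  idℤ i i                                       ≡⟨ U⁻¹U i i ⟨
  ∑ℤ n (λ a → U⁻¹ i a *ℤ U a i)                 ≡⟨ ∑ℤ-cong n (λ a → cong (U⁻¹ i a *ℤ_) (lookup∘tabulate (λ a → U a i) a)) ⟨
  ∑ℤ n (λ a → U⁻¹ i a *ℤ lookup column-i a)     ≡⟨ generators-annihilated vs generates (U⁻¹ i) row-annihilates column-i ⟩
  0ℤ                                            ∎)
  where
  open ≡.≡-Reasoning
  column-i : Vec ℤ n
  column-i = tabulate (λ a → U a i)
  row-annihilates : ∀ j → ∑ℤ n (λ a → U⁻¹ i a *ℤ colMat vs a j) ≡ 0ℤ
  row-annihilates j = trans (·-congˡ U⁻¹ Q≗UH i j) (trans (·-cancelˡ U⁻¹ U U⁻¹U H i j) (row-zero j))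
  1≢0 : 1ℤ ≢ 0ℤ
  1≢0 ()

colMat-map : ∀ {n} (M : ZMat n n) (vs : List (Vec ℤ n)) a j →
  colMat (map (M ·v_) vs) a j ≡ (M ·ℤ colMat vs) a (cast (length-map (M ·v_) vs) j)
colMat-map M (v ∷ vs) a fzero    = lookup∘tabulate _ a
colMat-map M (v ∷ vs) a (fsuc j) = colMat-map M vs a j

hnfDecomp-cast : ∀ {n p p'} (e : p' ≡ p) (Q : ZMat n p) {Q' : ZMat n p'} → (∀ a j → Q' a j ≡ Q a (cast e j)) →
  ∀ {U H'} → IsHNFDecomp Q' U H' → ∃ λ H → IsHNFDecomp Q U H
hnfDecomp-cast refl Q Q'≗Q {H' = H'} (glU , hnf , Q'≗UH') =
  H' , glU , hnf , λ a j → trans (sym (trans (Q'≗Q a j) (cong (Q a) (cast-is-id refl j)))) (Q'≗UH' a j)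

hnfDecomp-leftMul : ∀ {n p} (M M⁻¹ : ZMat n n) → IsInverse M M⁻¹ → (Q : ZMat n p) (U : ZMat n n) (H : ZMat n p) →
  IsHNFDecomp Q U H → IsHNFDecomp (M ·ℤ Q) (M ·ℤ U) H
hnfDecomp-leftMul M M⁻¹ M-inv Q U H ((U⁻¹ , U-inv) , hnf , Q≗UH) =
  (U⁻¹ ·ℤ M⁻¹ , inverse-· M M⁻¹ U U⁻¹ M-inv U-inv) , hnf ,
  λ i j → trans (·-congˡ M Q≗UH i j) (sym (·-assoc M U H i j))

hnfLeftFactor-map : ∀ {n} (vs : List (Vec ℤ n)) → Generates vs → (U : ZMat n n) (H : ZMat n (length vs)) →
  IsHNFDecomp (colMat vs) U H → (M M⁻¹ : ZMat n n) → IsInverse M M⁻¹ → ∀ {vs'} → vs' ≡ map (M ·v_) vs →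
  (U' : ZMat n n) (H' : ZMat n (length vs')) → IsHNFDecomp (colMat vs') U' H' → U' ≗ₘ M ·ℤ U
hnfLeftFactor-map vs generates U H decomp M M⁻¹ M-inv refl U' H' decomp'
  with hnfDecomp-cast (length-map (M ·v_) vs) (M ·ℤ colMat vs) (colMat-map M vs) decomp'
... | H″ , decomp″ =
  hnfDecomp-unique (M ·ℤ U) U' H H″ (hnfDecomp-leftMul M M⁻¹ M-inv (colMat vs) U H decomp) decomp″
                   (generates⇒noZeroRow vs generates U H decomp)

module FormAction {c ℓ ℓ'} (R : OrderedCommRing c ℓ ℓ') where
  open OrderedCommRing R renaming (refl to ≈-refl; sym to ≈-sym; trans to ≈-trans)
  open Forms R using (Mat; natR; fromℤ; act; _≈ₘ_)
  open FiniteSums commutativeRing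
  open import Algebra.Properties.Ring ring using (-0#≈0#; -‿involutive; -‿+-comm; -‿distribˡ-*)
  open import Algebra.Properties.CommutativeSemigroup +-commutativeSemigroup using (interchange)
  open import Relation.Binary.Reasoning.Setoid setoid

  natR-+ : ∀ m n → natR (m ℕ.+ n) ≈ natR m + natR n
  natR-+ zero    n = ≈-sym (+-identityˡ _)
  natR-+ (suc m) n = ≈-trans (+-congˡ (natR-+ m n)) (≈-sym (+-assoc _ _ _))

  fromℤ-⊖ : ∀ m n → fromℤ (m ℤ.⊖ n) ≈ natR m + - natR n
  fromℤ-⊖ m       zero    = ≈-sym (≈-trans (+-congˡ -0#≈0#) (+-identityʳ _))
  fromℤ-⊖ zero    (suc n) = ≈-sym (+-identityˡ _)
  fromℤ-⊖ (suc m) (suc n) = begin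
    fromℤ (suc m ℤ.⊖ suc n)            ≡⟨ ≡.cong fromℤ (ℤ.[1+m]⊖[1+n]≡m⊖n m n) ⟩
    fromℤ (m ℤ.⊖ n)                    ≈⟨ fromℤ-⊖ m n ⟩
    natR m + - natR n                  ≈⟨ +-identityˡ _ ⟨
    0# + (natR m + - natR n)           ≈⟨ +-congʳ (-‿inverseʳ 1#) ⟨
    (1# + - 1#) + (natR m + - natR n)  ≈⟨ interchange _ _ _ _ ⟩
    (1# + natR m) + (- 1# + - natR n)  ≈⟨ +-congˡ (-‿+-comm _ _) ⟩
    (1# + natR m) + - (1# + natR n)    ∎

  fromℤ-+ : ∀ i j → fromℤ (i +ℤ j) ≈ fromℤ i + fromℤ j
  fromℤ-+ (+ m)    (+ n)    = natR-+ m n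
  fromℤ-+ (+ m)    -[1+ n ] = fromℤ-⊖ m (suc n)
  fromℤ-+ -[1+ m ] (+ n)    = ≈-trans (fromℤ-⊖ n (suc m)) (+-comm _ _)
  fromℤ-+ -[1+ m ] -[1+ n ] = begin
    - natR (suc (suc (m ℕ.+ n)))     ≡⟨ ≡.cong (λ k → - natR (suc k)) (ℕ.+-suc m n) ⟨
    - natR (suc m ℕ.+ suc n)         ≈⟨ -‿cong (natR-+ (suc m) (suc n)) ⟩
    - (natR (suc m) + natR (suc n))  ≈⟨ -‿+-comm _ _ ⟨
    - natR (suc m) + - natR (suc n)  ∎

  fromℤ-neg : ∀ i → fromℤ (ℤ.- i) ≈ - fromℤ i
  fromℤ-neg (+ zero)  = ≈-sym -0#≈0#
  fromℤ-neg (+ suc m) = ≈-refl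
  fromℤ-neg -[1+ m ]  = ≈-sym (-‿involutive _)

  fromℤ-*-nonNeg : ∀ m j → fromℤ (+ m *ℤ j) ≈ natR m * fromℤ j
  fromℤ-*-nonNeg zero    j = ≈-trans (reflexive (≡.cong fromℤ (ℤ.*-zeroˡ j))) (≈-sym (zeroˡ _))
  fromℤ-*-nonNeg (suc m) j = begin
    fromℤ (+ suc m *ℤ j)             ≡⟨ ≡.cong fromℤ (ℤ.suc-* (+ m) j) ⟩
    fromℤ (j +ℤ + m *ℤ j)            ≈⟨ fromℤ-+ j _ ⟩
    fromℤ j + fromℤ (+ m *ℤ j)       ≈⟨ +-cong (≈-sym (*-identityˡ _)) (fromℤ-*-nonNeg m j) ⟩
    1# * fromℤ j + natR m * fromℤ j  ≈⟨ distribʳ _ _ _ ⟨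
    (1# + natR m) * fromℤ j          ∎

  fromℤ-* : ∀ i j → fromℤ (i *ℤ j) ≈ fromℤ i * fromℤ j
  fromℤ-* (+ m)    j = fromℤ-*-nonNeg m j
  fromℤ-* -[1+ m ] j = begin
    fromℤ (-[1+ m ] *ℤ j)       ≡⟨ ≡.cong fromℤ (ℤ.neg-distribˡ-* (+ suc m) j) ⟨
    fromℤ (ℤ.- (+ suc m *ℤ j))  ≈⟨ fromℤ-neg (+ suc m *ℤ j) ⟩
    - fromℤ (+ suc m *ℤ j)      ≈⟨ -‿cong (fromℤ-*-nonNeg (suc m) j) ⟩
    - (natR (suc m) * fromℤ j)  ≈⟨ -‿distribˡ-* _ _ ⟩
    - natR (suc m) * fromℤ j    ∎

  fromℤ-∑ : ∀ n (f : Fin n → ℤ) → fromℤ (∑ℤ n f) ≈ ∑R n (fromℤ ∘ f)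
  fromℤ-∑ zero    f = ≈-refl
  fromℤ-∑ (suc n) f = ≈-trans (fromℤ-+ (f fzero) _) (+-congˡ (fromℤ-∑ n (f ∘ fsuc)))

  fromℤ-· : ∀ {m k n} (X : ZMat m k) (Y : ZMat k n) a b →
    fromℤ ((X ·ℤ Y) a b) ≈ ∑R k (λ l → fromℤ (X a l) * fromℤ (Y l b))
  fromℤ-· {k = k} X Y a b = ≈-trans (fromℤ-∑ k _) (∑-cong k (λ l → fromℤ-* (X a l) (Y l b)))

  matSetoid : ℕ → Setoid c ℓ
  matSetoid n = Pointwise.≋-setoid (Pointwise.≋-setoid setoid n) n

  module ≈ₘ-Reasoning {n} = SetoidReasoning (matSetoid n)

  act-congˡ : ∀ {n} {X Y : ZMat n n} (B : Mat n) → X ≗ₘ Y → act X B ≈ₘ act Y B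
  act-congˡ {n} B X≗Y i j = ∑-cong n λ k → ∑-cong n λ l →
    reflexive (cong₂ (λ u v → (fromℤ u * B k l) * fromℤ v) (X≗Y k i) (X≗Y l j))

  act-congʳ : ∀ {n} (X : ZMat n n) {B C : Mat n} → B ≈ₘ C → act X B ≈ₘ act X C
  act-congʳ {n} X B≈C i j = ∑-cong n λ k → ∑-cong n λ l → *-congʳ (*-congˡ (B≈C k l))

  act-identity : ∀ {n} (B : Mat n) → act idℤ B ≈ₘ B
  act-identity {n} B i j = begin
    act idℤ B i j                                             ≈⟨ ∑-cong n (λ k → ∑-single n j _ λ l l≢j →
                                                                   ≈-trans (*-congˡ (δ-zero l≢j)) (zeroʳ _)) ⟩
    ∑R n (λ k → (fromℤ (idℤ k i) * B k j) * fromℤ (idℤ j j))  ≈⟨ ∑-single n i _ (λ k k≢i →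
                                                                   ≈-trans (*-congʳ (≈-trans (*-congʳ (δ-zero k≢i)) (zeroˡ _))) (zeroˡ _)) ⟩
    (fromℤ (idℤ i i) * B i j) * fromℤ (idℤ j j)               ≈⟨ *-cong (*-congʳ (δ-one i)) (δ-one j) ⟩
    (1# * B i j) * 1#                                         ≈⟨ ≈-trans (*-identityʳ _) (*-identityˡ _) ⟩
    B i j                                                     ∎
    where
    δ-zero : ∀ {a b : Fin n} → a ≢ b → fromℤ (idℤ a b) ≈ 0#
    δ-zero a≢b = reflexive (≡.cong fromℤ (idℤ-offDiag a≢b))
    δ-one : ∀ (a : Fin n) → fromℤ (idℤ a a) ≈ 1#
    δ-one a = ≈-trans (reflexive (≡.cong fromℤ (idℤ-diag a))) (+-identityʳ 1#)

  act-· : ∀ {n} (X Y : ZMat n n) (B : Mat n) → act (X ·ℤ Y) B ≈ₘ act Y (act X B)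
  act-· {n} X Y B i j = begin
    act (X ·ℤ Y) B i j
      ≈⟨ ∑-cong n (λ k → ∑-cong n (λ l → *-cong (*-congʳ (fromℤ-· X Y k i)) (fromℤ-· X Y l j))) ⟩
    ∑R n (λ k → ∑R n (λ l → (∑R n (λ a → x k a * y a i) * B k l) * ∑R n (λ b → x l b * y b j)))
      ≈⟨ ∑-cong n (λ k → ∑-cong n (λ l → expand-left k l)) ⟩
    ∑R n (λ k → ∑R n (λ l → ∑R n (λ a → ∑R n (λ b → ((x k a * y a i) * B k l) * (x l b * y b j)))))
      ≈⟨ ∑-cong n (λ k → ∑-cong n (λ l → ∑-cong n (λ a → ∑-cong n (λ b → regroup k l a b)))) ⟩
    ∑R n (λ k → ∑R n (λ l → ∑R n (λ a → ∑R n (λ b → (y a i * ((x k a * B k l) * x l b)) * y b j))))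
      ≈⟨ ∑∑-comm n n _ ⟩
    ∑R n (λ a → ∑R n (λ b → ∑R n (λ k → ∑R n (λ l → (y a i * ((x k a * B k l) * x l b)) * y b j))))
      ≈⟨ ∑-cong n (λ a → ∑-cong n (λ b → expand-right a b)) ⟨
    act Y (act X B) i j ∎
    where
    x y : Fin n → Fin n → Carrier
    x a b = fromℤ (X a b)
    y a b = fromℤ (Y a b)
    expand-left : ∀ k l → (∑R n (λ a → x k a * y a i) * B k l) * ∑R n (λ b → x l b * y b j) ≈
                  ∑R n (λ a → ∑R n (λ b → ((x k a * y a i) * B k l) * (x l b * y b j)))
    expand-left k l = ≈-trans (*-congʳ (*-distribʳ-∑ n _ _))
                        (≈-trans (*-distribʳ-∑ n _ _) (∑-cong n (λ a → *-distribˡ-∑ n _ _)))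
    expand-right : ∀ a b → (y a i * act X B a b) * y b j ≈
                   ∑R n (λ k → ∑R n (λ l → (y a i * ((x k a * B k l) * x l b)) * y b j))
    expand-right a b = ≈-trans (*-congʳ (≈-trans (*-distribˡ-∑ n _ _) (∑-cong n (λ k → *-distribˡ-∑ n _ _))))
                         (≈-trans (*-distribʳ-∑ n _ _) (∑-cong n (λ k → *-distribʳ-∑ n _ _)))
    regroup : ∀ k l a b → ((x k a * y a i) * B k l) * (x l b * y b j) ≈ (y a i * ((x k a * B k l) * x l b)) * y b j
    regroup k l a b = begin
      ((x k a * y a i) * B k l) * (x l b * y b j)  ≈⟨ *-congʳ (*-congʳ (*-comm _ _)) ⟩
      ((y a i * x k a) * B k l) * (x l b * y b j)  ≈⟨ *-congʳ (*-assoc _ _ _) ⟩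
      (y a i * (x k a * B k l)) * (x l b * y b j)  ≈⟨ *-assoc _ _ _ ⟨
      ((y a i * (x k a * B k l)) * x l b) * y b j  ≈⟨ *-congʳ (*-assoc _ _ _) ⟩
      (y a i * ((x k a * B k l) * x l b)) * y b j  ∎

module _ {c ℓ ℓ'} (R : OrderedCommRing c ℓ ℓ') where
  open Forms R using (Mat; act; _≈ₘ_)
  open FormAction R
  open ≈ₘ-Reasoning

  act-stabiliser-conjugate : ∀ {n} (A : Mat n) (P P⁻¹ S : ZMat n n) → IsInverse P P⁻¹ → act S A ≈ₘ A →
    act (P⁻¹ ·ℤ S) (act P A) ≈ₘ A
  act-stabiliser-conjugate A P P⁻¹ S (PP⁻¹ , _) SᵀAS≈A = begin
    act (P⁻¹ ·ℤ S) (act P A)   ≈⟨ act-· P⁻¹ S (act P A) ⟩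
    act S (act P⁻¹ (act P A))  ≈⟨ act-congʳ S (act-· P P⁻¹ A) ⟨
    act S (act (P ·ℤ P⁻¹) A)   ≈⟨ act-congʳ S (act-congˡ A PP⁻¹) ⟩
    act S (act idℤ A)          ≈⟨ act-congʳ S (act-identity A) ⟩
    act S A                    ≈⟨ SᵀAS≈A ⟩
    A                          ∎

proposition3p4p1 : ∀ {c ℓ ℓ'} (R : OrderedCommRing c ℓ ℓ') →
    (V : ∀ {n} → Forms.Mat R n → List (Vec ℤ n)) →
    Forms.IsCharVecFun R V → Forms.IsCanonicalOrdering R V →
    -- Can(A) := Uᵀ A U where Q_A = U H is the Hermite decomposition of Q_A
    ∀ {n} → 1 ≤ n → (A : Forms.Mat R n) → Forms.Form R A →
    (U : ZMat n n) (H : ZMat n (length (V A))) →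
    IsHNFDecomp (colMat (V A)) U H →
    -- (i) Can(A) is equivalent to A
    Forms.Equivalent R (Forms.act R U A) A
    ×
    -- (ii) Can(Pᵀ A P) = Can(A) for every P ∈ GL_n(ℤ)
    (∀ (P : ZMat n n) → GL P →
       (U' : ZMat n n) (H' : ZMat n (length (V (Forms.act R P A)))) →
       IsHNFDecomp (colMat (V (Forms.act R P A))) U' H' →
       Forms._≈ₘ_ R (Forms.act R U' (Forms.act R P A)) (Forms.act R U A))
proposition3p4p1 R V charVec canonical 1≤n A form U H decomp =
  (U , proj₁ decomp , λ _ _ → OrderedCommRing.refl R) , invariance
  where
  open Forms R using (act; _≈ₘ_)
  open FormAction R
  open ≈ₘ-Reasoning
  invariance : ∀ P → GL P → ∀ U' H' → IsHNFDecomp (colMat (V (act P A))) U' H' → act U' (act P A) ≈ₘ act U A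
  invariance P (P⁻¹ , P-inv) U' H' decomp' with canonical 1≤n A form P P⁻¹ P-inv
  ... | S , ((S⁻¹ , S-inv) , SᵀAS≈A) , V[PᵀAP]≡P⁻¹SV[A] = begin
    act U' (act P A)         ≈⟨ act-congˡ (act P A) U'≗MU ⟩
    act (M ·ℤ U) (act P A)   ≈⟨ act-· M U (act P A) ⟩
    act U (act M (act P A))  ≈⟨ act-congʳ U (act-stabiliser-conjugate R A P P⁻¹ S P-inv SᵀAS≈A) ⟩
    act U A                  ∎
    where
    M : ZMat _ _
    M = P⁻¹ ·ℤ S
    V[PᵀAP]≡MV[A] : V (act P A) ≡ map (M ·v_) (V A)
    V[PᵀAP]≡MV[A] = trans V[PᵀAP]≡P⁻¹SV[A] (map-cong (λ v → sym (·v-assoc P⁻¹ S v)) (V A))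
    U'≗MU : U' ≗ₘ M ·ℤ U
    U'≗MU = hnfLeftFactor-map (V A) (proj₁ (proj₂ (charVec 1≤n A form))) U H decomp
              M (S⁻¹ ·ℤ P) (inverse-· P⁻¹ P S S⁻¹ (inverse-sym P P⁻¹ P-inv) S-inv) V[PᵀAP]≡MV[A] U' H' decomp'
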